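{- For every integer $n\ge 1$, the number of $2_1$-Dyck paths of length $3n$ having exactly one down-step at a height of $1$ modulo $2$ and $n-1$ down-steps at a height of $2$ modulo $2$ equals the total number of peaks over all Dyck paths of length $2n$.
   Context: For non-negative integers $k,t,n$ with $0\le t<k$, a $k_t$-Dyck path of length $(k+1)n$ is a lattice path consisting of $n$ down-steps $(1,-k)$ and $kn$ up-steps $(1,1)$ that starts at $(0,0)$, ends at $((k+1)n,0)$, and stays weakly above the line $y=-t$. A down-step is at a height of $i$ modulo $k$ if its endpoint's $y$-coordinate is congruent to $i$ modulo $k$. A Dyck path of length $2n$ is a path of $n$ steps $(1,1)$ and $n$ steps $(1,-1)$ from $(0,0)$ to $(2n,0)$ staying weakly above the $x$-axis; a peak is an up-step immediately followed by a down-step. -}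

module Defs where

open import Data.Nat using (ℕ; zero; suc; _+_; _*_; _∸_; _%_; NonZero)
import Data.Nat as ℕ
open import Data.Integer using (ℤ; +_; -_; 0ℤ; _≤_; _≤?_)
import Data.Integer as ℤ
open import Data.Integer.DivMod using (_%ℕ_)
open import Data.List using (List; []; _∷_; length; filter; map; _++_; concatMap)
open import Data.List.Relation.Unary.All using (All; all?)
open import Data.Nat.ListAction using (sum)
open import Data.Product using (_×_; _,_)
open import Relation.Binary.PropositionalEquality using (_≡_)
open import Relation.Nullary using (Dec; yes; no; _×-dec_)
open import Relation.Unary using (Decidable)

-- A step of a lattice path: up = (1,1), down = (1,-k).
data Step : Set where
  up down : Step

allWords : ℕ → List (List Step)
allWords zero = [] ∷ []
allWords (suc m) = concatMap (λ w → (up ∷ w) ∷ (down ∷ w) ∷ []) (allWords m)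

delta : ℕ → Step → ℤ
delta k up = + 1
delta k down = - (+ k)

heights : ℕ → ℤ → List Step → List ℤ
heights k h [] = []
heights k h (s ∷ p) = (h ℤ.+ delta k s) ∷ heights k (h ℤ.+ delta k s) p

finalHeight : ℕ → ℤ → List Step → ℤ
finalHeight k h [] = h
finalHeight k h (s ∷ p) = finalHeight k (h ℤ.+ delta k s) p

downHeights : ℕ → ℤ → List Step → List ℤ
downHeights k h [] = []
downHeights k h (up ∷ p) = downHeights k (h ℤ.+ delta k up) p
downHeights k h (down ∷ p) = (h ℤ.+ delta k down) ∷ downHeights k (h ℤ.+ delta k down) p

countSteps : Step → List Step → ℕ
countSteps s [] = 0
countSteps up (up ∷ p) = suc (countSteps up p)
countSteps up (down ∷ p) = countSteps up p
countSteps down (up ∷ p) = countSteps down p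
countSteps down (down ∷ p) = suc (countSteps down p)

-- k_t-Dyck path of length (k+1)n: n down-steps, kn up-steps, starts at (0,0)
-- ends at height 0, and all points weakly above y = -t.
-- (The start point (0,0) is trivially above -t.)
IsKTDyck : (k t n : ℕ) → List Step → Set
IsKTDyck k t n p =
  countSteps down p ≡ n × countSteps up p ≡ k * n ×
  finalHeight k 0ℤ p ≡ 0ℤ × All (λ y → - (+ t) ≤ y) (heights k 0ℤ p)

isKTDyck? : (k t n : ℕ) → Decidable (IsKTDyck k t n)
isKTDyck? k t n p =
  (countSteps down p ℕ.≟ n) ×-dec (countSteps up p ℕ.≟ k * n) ×-dec
  (finalHeight k 0ℤ p ℤ.≟ 0ℤ) ×-dec all? (λ y → - (+ t) ≤? y) (heights k 0ℤ p)

ktDyckPaths : (k t n : ℕ) → List (List Step)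
ktDyckPaths k t n = filter (isKTDyck? k t n) (allWords ((k + 1) * n))

-- number of down-steps of p at a height of i modulo k
-- (endpoint y-coordinate congruent to i modulo k)
downsAtHeightMod : (k : ℕ) .{{_ : NonZero k}} → ℕ → List Step → ℕ
downsAtHeightMod k i p =
  length (filter (λ y → (y %ℕ k) ℕ.≟ (i % k)) (downHeights k 0ℤ p))

IsDyck : ℕ → List Step → Set
IsDyck n p =
  countSteps up p ≡ n × countSteps down p ≡ n ×
  finalHeight 1 0ℤ p ≡ 0ℤ × All (λ y → 0ℤ ≤ y) (heights 1 0ℤ p)

isDyck? : (n : ℕ) → Decidable (IsDyck n)
isDyck? n p =
  (countSteps up p ℕ.≟ n) ×-dec (countSteps down p ℕ.≟ n) ×-dec
  (finalHeight 1 0ℤ p ℤ.≟ 0ℤ) ×-dec all? (λ y → 0ℤ ≤? y) (heights 1 0ℤ p)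

dyckPaths : ℕ → List (List Step)
dyckPaths n = filter (isDyck? n) (allWords (2 * n))

peaks : List Step → ℕ
peaks [] = 0
peaks (up ∷ down ∷ p) = suc (peaks (down ∷ p))
peaks (_ ∷ p) = peaks p

totalPeaks : ℕ → ℕ
totalPeaks n = sum (map peaks (dyckPaths n))

countSpecial : ℕ → ℕ
countSpecial n = length (filter
  (λ p → (downsAtHeightMod 2 1 p ℕ.≟ 1) ×-dec (downsAtHeightMod 2 2 p ℕ.≟ n ∸ 1))
  (ktDyckPaths 2 1 n))

module Submission where

open import Defs
open import Data.Bool using (Bool; true; false)
open import Data.Empty using (⊥-elim)
open import Data.Integer as ℤ using (ℤ; +_; -[1+_]; -_; 0ℤ; -≤-; -≤+; +≤+)
open import Data.Integer.DivMod using (_%ℕ_; n%ℕd<d)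
import Data.Integer.Properties as ℤ
open import Data.Integer.Tactic.RingSolver using (solve-∀)
open import Data.List using (List; []; _∷_; length; map; filter; concatMap)
open import Data.List.Relation.Unary.All using (All; []; _∷_)
open import Data.Nat using (ℕ; zero; suc; _+_; _*_; _∸_; _<_; _≤_; _≟_; z≤n; s≤s)
open import Data.Nat.DivMod using (m*n%n≡0)
open import Data.Nat.ListAction using (sum)
open import Data.Nat.Properties
open import Algebra.Properties.CommutativeSemigroup +-commutativeSemigroup
  using (interchange; x∙yz≈y∙xz)
open import Data.Product using (_×_; _,_; proj₁; proj₂)
open import Function using (case_of_)
open import Relation.Nullary using (¬_; Dec; yes; no; does; _×-dec_)
open import Relation.Nullary.Decidable using (dec-true; dec-false)
open import Relation.Unary using (Decidable)
open import Relation.Binary.PropositionalEquality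

-- A 2₁-Dyck path in which every down-step but one ends at even height factors as
-- X · up down up · Y, the middle down-step being the one ending at odd height: the parity of the
-- height is that of the number of up-steps taken, so outside this factor up-steps come in pairs.
-- Contracting each pair to one up-step and the factor to a peak up down yields a Dyck path of
-- length 2n with a marked peak, and conversely. Instead of building this bijection, both families
-- are recognised by automata reading a path step by step; summed over all words of the right
-- length, their counts, indexed by the number p of (pairs of) up-steps and the starting height h,
-- satisfy the same recurrence x(p,h) = x(p−1,h+1) + s(p,h) + x(p,h−1) (terms with a negative
-- index being 0), whose solution is determined by its source term s.

toℕ : Bool → ℕ
toℕ true  = 1
toℕ false = 0

sum-map-+ : ∀ {A : Set} (f g : A → ℕ) xs →
  sum (map (λ x → f x + g x) xs) ≡ sum (map f xs) + sum (map g xs)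
sum-map-+ f g []       = refl
sum-map-+ f g (x ∷ xs) = begin
  f x + g x + sum (map (λ x → f x + g x) xs)    ≡⟨ cong (_+_ (f x + g x)) (sum-map-+ f g xs) ⟩
  f x + g x + (sum (map f xs) + sum (map g xs)) ≡⟨ interchange (f x) (g x) _ _ ⟩
  f x + sum (map f xs) + (g x + sum (map g xs)) ∎
  where open ≡-Reasoning

length-filter≡sum : ∀ {A : Set} {P : A → Set} (P? : Decidable P) xs →
  length (filter P? xs) ≡ sum (map (λ x → toℕ (does (P? x))) xs)
length-filter≡sum P? []       = refl
length-filter≡sum P? (x ∷ xs) with does (P? x)
... | true  = cong suc (length-filter≡sum P? xs)
... | false = length-filter≡sum P? xs

sum-map-filter : ∀ {A : Set} {P : A → Set} (P? : Decidable P) (f : A → ℕ) xs →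
  sum (map f (filter P? xs)) ≡ sum (map (λ x → toℕ (does (P? x)) * f x) xs)
sum-map-filter P? f []       = refl
sum-map-filter P? f (x ∷ xs) with does (P? x)
... | true  = cong₂ _+_ (sym (+-identityʳ (f x))) (sum-map-filter P? f xs)
... | false = sum-map-filter P? f xs

does-≡ : ∀ {X : Set} (X? : Dec X) {b} → (X → b ≡ true) → (b ≡ true → X) → does X? ≡ b
does-≡ X? {true}  _    from = dec-true X? (from refl)
does-≡ X? {false} into _    = dec-false X? (λ x → case into x of λ ())

toℕ-does-×-dec : ∀ {X Y : Set} (X? : Dec X) (Y? : Dec Y) →
  toℕ (does (X? ×-dec Y?)) ≡ toℕ (does X?) * toℕ (does Y?)
toℕ-does-×-dec (yes _) (yes _) = refl
toℕ-does-×-dec (yes _) (no _)  = refl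
toℕ-does-×-dec (no _)  _       = refl

sumWords : ℕ → (List Step → ℕ) → ℕ
sumWords m F = sum (map F (allWords m))

sumWords-suc : ∀ m F →
  sumWords (suc m) F ≡ sumWords m (λ w → F (up ∷ w)) + sumWords m (λ w → F (down ∷ w))
sumWords-suc m F = go (allWords m)
  where
  go : ∀ ws → sum (map F (concatMap (λ w → (up ∷ w) ∷ (down ∷ w) ∷ []) ws))
            ≡ sum (map (λ w → F (up ∷ w)) ws) + sum (map (λ w → F (down ∷ w)) ws)
  go []       = refl
  go (w ∷ ws) = begin
    a + (b + rest)  ≡⟨ sym (+-assoc a b rest) ⟩
    a + b + rest    ≡⟨ cong (_+_ (a + b)) (go ws) ⟩
    a + b + (s + t) ≡⟨ interchange a b s t ⟩
    a + s + (b + t) ∎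
    where
    open ≡-Reasoning
    a = F (up ∷ w)
    b = F (down ∷ w)
    rest = sum (map F (concatMap (λ w → (up ∷ w) ∷ (down ∷ w) ∷ []) ws))
    s = sum (map (λ w → F (up ∷ w)) ws)
    t = sum (map (λ w → F (down ∷ w)) ws)

sumWords-cong : ∀ m {F G : List Step → ℕ} → (∀ w → length w ≡ m → F w ≡ G w) →
  sumWords m F ≡ sumWords m G
sumWords-cong zero    F≗G = cong (_+ 0) (F≗G [] refl)
sumWords-cong (suc m) {F} {G} F≗G = begin
  sumWords (suc m) F                                                ≡⟨ sumWords-suc m F ⟩
  sumWords m (λ w → F (up ∷ w)) + sumWords m (λ w → F (down ∷ w))
    ≡⟨ cong₂ _+_ (sumWords-cong m (λ w e → F≗G (up ∷ w) (cong suc e)))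
                 (sumWords-cong m (λ w e → F≗G (down ∷ w) (cong suc e))) ⟩
  sumWords m (λ w → G (up ∷ w)) + sumWords m (λ w → G (down ∷ w))  ≡⟨ sym (sumWords-suc m G) ⟩
  sumWords (suc m) G                                                ∎
  where open ≡-Reasoning

sumWords-zero : ∀ m → sumWords m (λ _ → 0) ≡ 0
sumWords-zero zero    = refl
sumWords-zero (suc m) = trans (sumWords-suc m _) (cong₂ _+_ (sumWords-zero m) (sumWords-zero m))

sumWords-vanishes : ∀ m {F : List Step → ℕ} → (∀ w → length w ≡ m → F w ≡ 0) → sumWords m F ≡ 0
sumWords-vanishes m F≗0 = trans (sumWords-cong m F≗0) (sumWords-zero m)

sumWords-short : ∀ m {F : List Step → ℕ} {b} → m ≤ b → (∀ w → length w ≤ b → F w ≡ 0) →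
  sumWords m F ≡ 0
sumWords-short m {b = b} m≤b F≗0 =
  sumWords-vanishes m (λ w |w|≡m → F≗0 w (subst (_≤ b) (sym |w|≡m) m≤b))

sumWords-+ : ∀ m (F G : List Step → ℕ) →
  sumWords m (λ w → F w + G w) ≡ sumWords m F + sumWords m G
sumWords-+ m F G = sum-map-+ F G (allWords m)

sumWords-shift : ∀ h k n (F : List Step → ℕ) → sumWords (h + (k + n)) F ≡ sumWords (k + (h + n)) F
sumWords-shift h k n F = cong (λ m → sumWords m F) (x∙yz≈y∙xz h k n)

-- The ballot recurrence

atPred : (ℕ → ℕ) → ℕ → ℕ
atPred f zero    = 0
atPred f (suc n) = f n

BallotRecurrence : (s x : ℕ → ℕ → ℕ) → Set
BallotRecurrence s x =
  ∀ p h → x p h ≡ atPred (λ p′ → x p′ (suc h)) p + s p h + atPred (x p) h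

ballotRecurrence-unique : ∀ {s t x y} → (∀ p h → s p h ≡ t p h) →
  BallotRecurrence s x → BallotRecurrence t y → ∀ p h → x p h ≡ y p h
ballotRecurrence-unique {s} {t} {x} {y} s≗t rec-x rec-y = go
  where
  go : ∀ p h → x p h ≡ y p h
  earlier : ∀ p h → atPred (λ p′ → x p′ (suc h)) p ≡ atPred (λ p′ → y p′ (suc h)) p
  lower : ∀ p h → atPred (x p) h ≡ atPred (y p) h

  go p h = begin
    x p h                                                    ≡⟨ rec-x p h ⟩
    atPred (λ p′ → x p′ (suc h)) p + s p h + atPred (x p) h
      ≡⟨ cong₂ _+_ (cong₂ _+_ (earlier p h) (s≗t p h)) (lower p h) ⟩
    atPred (λ p′ → y p′ (suc h)) p + t p h + atPred (y p) h  ≡⟨ sym (rec-y p h) ⟩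
    y p h                                                    ∎
    where open ≡-Reasoning
  earlier zero    h = refl
  earlier (suc p) h = go p (suc h)
  lower p zero    = refl
  lower p (suc h) = go p h

DescendsOnDown : (ℕ → List Step → ℕ) → Set
DescendsOnDown F = ∀ h w → F h (down ∷ w) ≡ atPred (λ h′ → F h′ w) h

module _ {F : ℕ → List Step → ℕ} (descends : DescendsOnDown F) where

  sumWords-descends-zero : ∀ m → sumWords (suc m) (F 0) ≡ sumWords m (λ w → F 0 (up ∷ w))
  sumWords-descends-zero m = begin
    sumWords (suc m) (F 0)                                    ≡⟨ sumWords-suc m (F 0) ⟩
    U + sumWords m (λ w → F 0 (down ∷ w))
      ≡⟨ cong (_+_ U) (sumWords-vanishes m (λ w _ → descends 0 w)) ⟩
    U + 0                                                     ≡⟨ +-identityʳ U ⟩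
    U                                                         ∎
    where
    open ≡-Reasoning
    U = sumWords m (λ w → F 0 (up ∷ w))

  sumWords-descends-suc : ∀ m h →
    sumWords (suc m) (F (suc h)) ≡ sumWords m (λ w → F (suc h) (up ∷ w)) + sumWords m (F h)
  sumWords-descends-suc m h = trans (sumWords-suc m (F (suc h)))
    (cong (_+_ (sumWords m (λ w → F (suc h) (up ∷ w))))
          (sumWords-cong m (λ w _ → descends (suc h) w)))

ballot : ℕ → List Step → Bool
ballot h       (up ∷ w)   = ballot (suc h) w
ballot zero    []         = true
ballot (suc _) []         = false
ballot zero    (down ∷ _) = false
ballot (suc h) (down ∷ w) = ballot h w

ballot-short : ∀ h w → length w < h → ballot h w ≡ false
ballot-short (suc h) []         _           = refl
ballot-short h       (up ∷ w)   1+|w|<h     =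
  ballot-short (suc h) w (m<n⇒m<1+n (<-trans (n<1+n _) 1+|w|<h))
ballot-short (suc h) (down ∷ w) (s≤s |w|<h) = ballot-short h w |w|<h

Ballot : ℕ → List Step → ℕ
Ballot h w = toℕ (ballot h w)

ballot-descends : DescendsOnDown Ballot
ballot-descends zero    w = refl
ballot-descends (suc h) w = refl

-- ballotCount p h counts words with p up-steps and p + h down-steps, afterOddCount p h words
-- with p pairs of up-steps and p + h down-steps; beforeOddCount and markedPeakCount count such
-- words with an extra factor up down up, respectively up down, inserted.
ballotCount : ℕ → ℕ → ℕ
ballotCount p h = sumWords (h + p * 2) (Ballot h)

atOrigin : ℕ → ℕ → ℕ
atOrigin _       (suc _) = 0
atOrigin zero    zero    = 1
atOrigin (suc _) zero    = 0

ballotCount-up : ∀ p h →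
  sumWords (h + p * 2) (Ballot (suc (suc h))) ≡ atPred (λ p′ → ballotCount p′ (suc (suc h))) p
ballotCount-up zero    h = sumWords-short (h + 0) (≤-reflexive (+-identityʳ h)) (λ w |w|≤h →
  cong toℕ (ballot-short (suc (suc h)) w (s≤s (m≤n⇒m≤1+n |w|≤h))))
ballotCount-up (suc p) h = sumWords-shift h 2 (p * 2) _

ballotCount-recurrence : BallotRecurrence atOrigin ballotCount
ballotCount-recurrence zero    zero    = refl
ballotCount-recurrence (suc p) zero    =
  trans (sumWords-descends-zero ballot-descends (suc (p * 2)))
        (sym (trans (+-identityʳ _) (+-identityʳ _)))
ballotCount-recurrence p       (suc h) =
  trans (sumWords-descends-suc ballot-descends (h + p * 2) h)
        (cong (_+ ballotCount p h) (trans (ballotCount-up p h) (sym (+-identityʳ _))))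

BallotPeaks : ℕ → List Step → ℕ
BallotPeaks h w = Ballot h w * peaks w

ballotPeaks-descends : DescendsOnDown BallotPeaks
ballotPeaks-descends zero    w = refl
ballotPeaks-descends (suc h) w = refl

ballotPeaks-short : ∀ h w → length w ≤ h → BallotPeaks h w ≡ 0
ballotPeaks-short h       []         _           = *-zeroʳ (Ballot h [])
ballotPeaks-short h       (up ∷ w)   |w|<h       =
  cong (λ b → toℕ b * peaks (up ∷ w)) (ballot-short (suc h) w (s≤s (<⇒≤ |w|<h)))
ballotPeaks-short zero    (down ∷ w) _           = refl
ballotPeaks-short (suc h) (down ∷ w) (s≤s |w|≤h) = ballotPeaks-short h w |w|≤h

sumWords-ballotPeaks-up : ∀ m h →
  sumWords (suc m) (λ w → BallotPeaks h (up ∷ w))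
    ≡ sumWords (suc m) (BallotPeaks (suc h)) + sumWords m (Ballot h)
sumWords-ballotPeaks-up m h = begin
  sumWords (suc m) (λ w → BallotPeaks h (up ∷ w))         ≡⟨ sumWords-suc m _ ⟩
  U + sumWords m (λ w → BallotPeaks h (up ∷ down ∷ w))    ≡⟨ cong (_+_ U) (sumWords-cong m (λ w _ → peak w)) ⟩
  U + sumWords m (λ w → BallotPeaks (suc h) (down ∷ w) + Ballot h w)
    ≡⟨ cong (_+_ U) (sumWords-+ m _ (Ballot h)) ⟩
  U + (D + B)                                             ≡⟨ sym (+-assoc U D B) ⟩
  U + D + B                                               ≡⟨ cong (_+ B) (sym (sumWords-suc m _)) ⟩
  sumWords (suc m) (BallotPeaks (suc h)) + B              ∎
  where
  open ≡-Reasoning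
  U = sumWords m (λ w → BallotPeaks (suc h) (up ∷ w))
  D = sumWords m (λ w → BallotPeaks (suc h) (down ∷ w))
  B = sumWords m (Ballot h)
  peak : ∀ w → BallotPeaks h (up ∷ down ∷ w) ≡ BallotPeaks (suc h) (down ∷ w) + Ballot h w
  peak w = trans (*-suc (Ballot h w) (peaks w)) (+-comm (Ballot h w) _)

markedPeakCount : ℕ → ℕ → ℕ
markedPeakCount p h = sumWords (2 + (h + p * 2)) (BallotPeaks h)

markedPeakCount-up : ∀ p h →
  sumWords (suc (h + p * 2)) (λ w → BallotPeaks h (up ∷ w))
    ≡ atPred (λ p′ → markedPeakCount p′ (suc h)) p + ballotCount p h
markedPeakCount-up p h =
  trans (sumWords-ballotPeaks-up (h + p * 2) h) (cong (_+ ballotCount p h) (earlier p))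
  where
  earlier : ∀ p → sumWords (suc (h + p * 2)) (BallotPeaks (suc h))
                    ≡ atPred (λ p′ → markedPeakCount p′ (suc h)) p
  earlier zero    =
    sumWords-short (suc (h + 0)) (s≤s (≤-reflexive (+-identityʳ h))) (ballotPeaks-short (suc h))
  earlier (suc p) = sumWords-shift (suc h) 2 (p * 2) _

markedPeakCount-recurrence : BallotRecurrence ballotCount markedPeakCount
markedPeakCount-recurrence p zero    =
  trans (sumWords-descends-zero ballotPeaks-descends (suc (p * 2)))
        (trans (markedPeakCount-up p 0) (sym (+-identityʳ _)))
markedPeakCount-recurrence p (suc h) =
  trans (sumWords-descends-suc ballotPeaks-descends (suc (suc (h + p * 2))) h)
        (cong (_+ markedPeakCount p h) (markedPeakCount-up p (suc h)))

-- The state h of beforeOdd and afterOdd is at height 2h, that of beforeOdd′ at 2h + 1 and that of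
-- afterOdd′ at 2h − 1; afterOdd and afterOdd′ have already taken the down-step ending at odd height.
mutual
  beforeOdd : ℕ → List Step → Bool
  beforeOdd h       []         = false
  beforeOdd h       (up ∷ w)   = beforeOdd′ h w
  beforeOdd zero    (down ∷ _) = false
  beforeOdd (suc h) (down ∷ w) = beforeOdd h w

  beforeOdd′ : ℕ → List Step → Bool
  beforeOdd′ h []         = false
  beforeOdd′ h (up ∷ w)   = beforeOdd (suc h) w
  beforeOdd′ h (down ∷ w) = afterOdd′ h w

  afterOdd : ℕ → List Step → Bool
  afterOdd h       (up ∷ w)   = afterOdd′ (suc h) w
  afterOdd zero    []         = true
  afterOdd (suc _) []         = false
  afterOdd zero    (down ∷ _) = false
  afterOdd (suc h) (down ∷ w) = afterOdd h w

  afterOdd′ : ℕ → List Step → Bool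
  afterOdd′ h []         = false
  afterOdd′ h (up ∷ w)   = afterOdd h w
  afterOdd′ h (down ∷ _) = false

mutual
  afterOdd-short : ∀ h w → length w < h → afterOdd h w ≡ false
  afterOdd-short h       (up ∷ w)   1+|w|<h     =
    afterOdd′-short (suc h) w (<-trans (n<1+n _) (m<n⇒m<1+n 1+|w|<h))
  afterOdd-short (suc h) []         _           = refl
  afterOdd-short zero    (down ∷ w) _           = refl
  afterOdd-short (suc h) (down ∷ w) (s≤s |w|<h) = afterOdd-short h w |w|<h

  afterOdd′-short : ∀ h w → length w < h → afterOdd′ h w ≡ false
  afterOdd′-short h []         _       = refl
  afterOdd′-short h (up ∷ w)   1+|w|<h = afterOdd-short h w (<-trans (n<1+n _) 1+|w|<h)
  afterOdd′-short h (down ∷ w) _       = refl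

mutual
  beforeOdd-short : ∀ h w → length w ≤ h → beforeOdd h w ≡ false
  beforeOdd-short h       []         _           = refl
  beforeOdd-short h       (up ∷ w)   |w|<h       = beforeOdd′-short h w |w|<h
  beforeOdd-short zero    (down ∷ w) _           = refl
  beforeOdd-short (suc h) (down ∷ w) (s≤s |w|≤h) = beforeOdd-short h w |w|≤h

  beforeOdd′-short : ∀ h w → length w < h → beforeOdd′ h w ≡ false
  beforeOdd′-short h []         _       = refl
  beforeOdd′-short h (up ∷ w)   1+|w|<h =
    beforeOdd-short (suc h) w (m≤n⇒m≤1+n (≤-trans (n≤1+n _) (<⇒≤ 1+|w|<h)))
  beforeOdd′-short h (down ∷ w) 1+|w|<h = afterOdd′-short h w (<-trans (n<1+n _) 1+|w|<h)

BeforeOdd BeforeOdd′ AfterOdd AfterOdd′ : ℕ → List Step → ℕ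
BeforeOdd  h w = toℕ (beforeOdd h w)
BeforeOdd′ h w = toℕ (beforeOdd′ h w)
AfterOdd   h w = toℕ (afterOdd h w)
AfterOdd′  h w = toℕ (afterOdd′ h w)

beforeOdd-descends : DescendsOnDown BeforeOdd
beforeOdd-descends zero    w = refl
beforeOdd-descends (suc h) w = refl

afterOdd-descends : DescendsOnDown AfterOdd
afterOdd-descends zero    w = refl
afterOdd-descends (suc h) w = refl

sumWords-afterOdd′ : ∀ m h → sumWords (suc m) (AfterOdd′ h) ≡ sumWords m (AfterOdd h)
sumWords-afterOdd′ m h = trans (sumWords-suc m (AfterOdd′ h))
  (trans (cong (_+_ (sumWords m (AfterOdd h))) (sumWords-zero m)) (+-identityʳ _))

afterOddCount : ℕ → ℕ → ℕ
afterOddCount p h = sumWords (h + p * 3) (AfterOdd h)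

afterOddCount-up : ∀ p h →
  sumWords (h + p * 3) (AfterOdd′ (suc (suc h))) ≡ atPred (λ p′ → afterOddCount p′ (suc (suc h))) p
afterOddCount-up zero    h = sumWords-short (h + 0) (≤-reflexive (+-identityʳ h)) (λ w |w|≤h →
  cong toℕ (afterOdd′-short (suc (suc h)) w (s≤s (m≤n⇒m≤1+n |w|≤h))))
afterOddCount-up (suc p) h = trans (sumWords-shift h 3 (p * 3) _)
  (sumWords-afterOdd′ (suc (suc (h + p * 3))) (suc (suc h)))

afterOddCount-recurrence : BallotRecurrence atOrigin afterOddCount
afterOddCount-recurrence zero    zero    = refl
afterOddCount-recurrence (suc p) zero    =
  trans (sumWords-descends-zero afterOdd-descends (suc (suc (p * 3))))
        (trans (sumWords-afterOdd′ (suc (p * 3)) 1) (sym (trans (+-identityʳ _) (+-identityʳ _))))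
afterOddCount-recurrence p       (suc h) =
  trans (sumWords-descends-suc afterOdd-descends (h + p * 3) h)
        (cong (_+ afterOddCount p h) (trans (afterOddCount-up p h) (sym (+-identityʳ _))))

beforeOddCount : ℕ → ℕ → ℕ
beforeOddCount p h = sumWords (3 + (h + p * 3)) (BeforeOdd h)

beforeOddCount-up : ∀ p h →
  sumWords (suc (suc (h + p * 3))) (λ w → BeforeOdd h (up ∷ w))
    ≡ atPred (λ p′ → beforeOddCount p′ (suc h)) p + afterOddCount p h
beforeOddCount-up p h =
  trans (sumWords-suc (suc (h + p * 3)) (BeforeOdd′ h))
        (cong₂ _+_ (earlier p) (sumWords-afterOdd′ (h + p * 3) h))
  where
  earlier : ∀ p → sumWords (suc (h + p * 3)) (BeforeOdd (suc h))
                    ≡ atPred (λ p′ → beforeOddCount p′ (suc h)) p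
  earlier zero    = sumWords-short (suc (h + 0)) (s≤s (≤-reflexive (+-identityʳ h)))
    (λ w |w|≤1+h → cong toℕ (beforeOdd-short (suc h) w |w|≤1+h))
  earlier (suc p) = sumWords-shift (suc h) 3 (p * 3) _

beforeOddCount-recurrence : BallotRecurrence afterOddCount beforeOddCount
beforeOddCount-recurrence p zero    =
  trans (sumWords-descends-zero beforeOdd-descends (suc (suc (p * 3))))
        (trans (beforeOddCount-up p 0) (sym (+-identityʳ _)))
beforeOddCount-recurrence p (suc h) =
  trans (sumWords-descends-suc beforeOdd-descends (suc (suc (suc (h + p * 3)))) h)
        (cong (_+ beforeOddCount p h) (beforeOddCount-up p (suc h)))

afterOddCount≡ballotCount : ∀ p h → afterOddCount p h ≡ ballotCount p h
afterOddCount≡ballotCount =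
  ballotRecurrence-unique (λ _ _ → refl) afterOddCount-recurrence ballotCount-recurrence

beforeOddCount≡markedPeakCount : ∀ p h → beforeOddCount p h ≡ markedPeakCount p h
beforeOddCount≡markedPeakCount =
  ballotRecurrence-unique afterOddCount≡ballotCount beforeOddCount-recurrence markedPeakCount-recurrence

-- The automata recognise the paths of the theorem

countOdd : List ℤ → ℕ
countOdd ys = length (filter (λ y → y %ℕ 2 ≟ 1) ys)

countEven : List ℤ → ℕ
countEven ys = length (filter (λ y → y %ℕ 2 ≟ 0) ys)

countOdd-∷ : ∀ y ys → countOdd (y ∷ ys) ≡ y %ℕ 2 + countOdd ys
countOdd-∷ y ys with y %ℕ 2 | n%ℕd<d y 2
... | 0           | _                = refl
... | 1           | _                = refl
... | suc (suc _) | s≤s (s≤s ())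

countOdd+countEven : ∀ ys → countOdd ys + countEven ys ≡ length ys
countOdd+countEven []       = refl
countOdd+countEven (y ∷ ys) with y %ℕ 2 | n%ℕd<d y 2
... | 0           | _ = trans (+-suc (countOdd ys) (countEven ys)) (cong suc (countOdd+countEven ys))
... | 1           | _ = cong suc (countOdd+countEven ys)
... | suc (suc _) | s≤s (s≤s ())

length≡countUp+countDown : ∀ w → length w ≡ countSteps up w + countSteps down w
length≡countUp+countDown []         = refl
length≡countUp+countDown (up ∷ w)   = cong suc (length≡countUp+countDown w)
length≡countUp+countDown (down ∷ w) =
  trans (cong suc (length≡countUp+countDown w)) (sym (+-suc (countSteps up w) (countSteps down w)))

length-downHeights : ∀ k h w → length (downHeights k h w) ≡ countSteps down w
length-downHeights k h []         = refl
length-downHeights k h (up ∷ w)   = length-downHeights k (h ℤ.+ + 1) w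
length-downHeights k h (down ∷ w) = cong suc (length-downHeights k (h ℤ.+ - + k) w)

finalHeight-counts : ∀ k h w →
  finalHeight k h w ℤ.+ + (k * countSteps down w) ≡ h ℤ.+ + countSteps up w
finalHeight-counts k h []         = cong (λ m → h ℤ.+ + m) (*-zeroʳ k)
finalHeight-counts k h (up ∷ w)   =
  trans (finalHeight-counts k (h ℤ.+ + 1) w) (ℤ.+-assoc h (+ 1) (+ countSteps up w))
finalHeight-counts k h (down ∷ w) = begin
  F ℤ.+ + (k * suc d)                  ≡⟨ cong (λ m → F ℤ.+ + m) (*-suc k d) ⟩
  F ℤ.+ (+ k ℤ.+ + (k * d))            ≡⟨ regroup F (+ k) (+ (k * d)) ⟩
  (F ℤ.+ + (k * d)) ℤ.+ + k            ≡⟨ cong (ℤ._+ + k) (finalHeight-counts k (h ℤ.+ - + k) w) ⟩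
  (h ℤ.+ - + k ℤ.+ + u) ℤ.+ + k        ≡⟨ cancel h (+ u) (+ k) ⟩
  h ℤ.+ + u                            ∎
  where
  open ≡-Reasoning
  F = finalHeight k (h ℤ.+ - + k) w
  d = countSteps down w
  u = countSteps up w
  regroup : ∀ x y z → x ℤ.+ (y ℤ.+ z) ≡ (x ℤ.+ z) ℤ.+ y
  regroup = solve-∀
  cancel : ∀ x u y → (x ℤ.+ - y ℤ.+ u) ℤ.+ y ≡ x ℤ.+ u
  cancel = solve-∀

closedPath-counts : ∀ k n w → finalHeight k 0ℤ w ≡ 0ℤ → length w ≡ suc k * n →
  countSteps down w ≡ n × countSteps up w ≡ k * n
closedPath-counts k n w closed |w|≡[1+k]n = d≡n , trans (sym kd≡u) (cong (k *_) d≡n)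
  where
  d = countSteps down w
  u = countSteps up w
  kd≡u : k * d ≡ u
  kd≡u = ℤ.+-injective (trans (cong (ℤ._+ + (k * d)) (sym closed)) (finalHeight-counts k 0ℤ w))
  d≡n : d ≡ n
  d≡n = *-cancelˡ-≡ d n (suc k) (begin
    suc k * d  ≡⟨ +-comm d (k * d) ⟩
    k * d + d  ≡⟨ cong (_+ d) kd≡u ⟩
    u + d      ≡⟨ sym (length≡countUp+countDown w) ⟩
    length w   ≡⟨ |w|≡[1+k]n ⟩
    suc k * n  ∎)
    where open ≡-Reasoning

record ReturnsToZero (k t : ℕ) (h : ℤ) (w : List Step) : Set where
  constructor returns
  field
    staysAbove : All (λ y → - (+ t) ℤ.≤ y) (heights k h w)
    endsAtZero : finalHeight k h w ≡ 0ℤ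

returnsToZero-step⁻ : ∀ {k t h h′ s w} → h ℤ.+ delta k s ≡ h′ →
  ReturnsToZero k t h (s ∷ w) → ReturnsToZero k t h′ w
returnsToZero-step⁻ refl (returns (_ ∷ above) ends) = returns above ends

returnsToZero-step⁺ : ∀ {k t h h′ s w} → h ℤ.+ delta k s ≡ h′ → - (+ t) ℤ.≤ h′ →
  ReturnsToZero k t h′ w → ReturnsToZero k t h (s ∷ w)
returnsToZero-step⁺ refl bounded (returns above ends) = returns (bounded ∷ above) ends

oddDowns : ℤ → List Step → ℕ
oddDowns h w = countOdd (downHeights 2 h w)

Special : ℕ → ℤ → List Step → Set
Special j h w = ReturnsToZero 2 1 h w × oddDowns h w ≡ j

special-up⁻ : ∀ {j h h′ w} → h ℤ.+ + 1 ≡ h′ → Special j h (up ∷ w) → Special j h′ w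
special-up⁻ refl (r , odd) = returnsToZero-step⁻ refl r , odd

special-up⁺ : ∀ {j h h′ w} → h ℤ.+ + 1 ≡ h′ → -[1+ 0 ] ℤ.≤ h′ →
  Special j h′ w → Special j h (up ∷ w)
special-up⁺ refl bounded (r , odd) = returnsToZero-step⁺ refl bounded r , odd

special-down⁻ : ∀ {i j h h′ w} → h ℤ.+ -[1+ 1 ] ≡ h′ → h′ %ℕ 2 ≡ i →
  Special (i + j) h (down ∷ w) → Special j h′ w
special-down⁻ {i} {h′ = h′} {w} refl parity (r , odd) =
  returnsToZero-step⁻ refl r ,
  +-cancelˡ-≡ i _ _ (trans (cong (_+ oddDowns h′ w) (sym parity)) (trans (sym (countOdd-∷ h′ _)) odd))

special-down⁺ : ∀ {i j h h′ w} → h ℤ.+ -[1+ 1 ] ≡ h′ → h′ %ℕ 2 ≡ i → -[1+ 0 ] ℤ.≤ h′ →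
  Special j h′ w → Special (i + j) h (down ∷ w)
special-down⁺ {h′ = h′} refl parity bounded (r , odd) =
  returnsToZero-step⁺ refl bounded r , trans (countOdd-∷ h′ _) (cong₂ _+_ parity odd)

special-odd-exhausted : ∀ {h h′ w} → h ℤ.+ -[1+ 1 ] ≡ h′ → h′ %ℕ 2 ≡ 1 →
  ¬ Special 0 h (down ∷ w)
special-odd-exhausted {h′ = h′} {w} refl parity (_ , odd) =
  1+n≢0 (trans (sym (trans (countOdd-∷ h′ _) (cong (_+ oddDowns h′ w) parity))) odd)

evenAt oddAbove oddBelow : ℕ → ℤ
evenAt   h       = + (h * 2)
oddAbove h       = + suc (h * 2)
oddBelow zero    = -[1+ 0 ]
oddBelow (suc h) = oddAbove h

evenAt-up : ∀ h → evenAt h ℤ.+ + 1 ≡ oddAbove h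
evenAt-up h = cong +_ (+-comm (h * 2) 1)

oddAbove-up : ∀ h → oddAbove h ℤ.+ + 1 ≡ evenAt (suc h)
oddAbove-up h = cong +_ (+-comm (suc (h * 2)) 1)

oddBelow-up : ∀ h → oddBelow h ℤ.+ + 1 ≡ evenAt h
oddBelow-up zero    = refl
oddBelow-up (suc h) = oddAbove-up h

oddAbove-down : ∀ h → oddAbove h ℤ.+ -[1+ 1 ] ≡ oddBelow h
oddAbove-down zero    = refl
oddAbove-down (suc h) = refl

evenAt-parity : ∀ h → evenAt h %ℕ 2 ≡ 0
evenAt-parity h = m*n%n≡0 h 2

oddBelow-parity : ∀ h → oddBelow h %ℕ 2 ≡ 1
oddBelow-parity zero          = refl
oddBelow-parity (suc zero)    = refl
oddBelow-parity (suc (suc h)) = oddBelow-parity (suc h)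

oddBelow-bounded : ∀ h → -[1+ 0 ] ℤ.≤ oddBelow h
oddBelow-bounded zero    = -≤- z≤n
oddBelow-bounded (suc h) = -≤+

mutual
  beforeOdd-complete : ∀ h w → Special 1 (evenAt h) w → beforeOdd h w ≡ true
  beforeOdd-complete h       []         (_ , ())
  beforeOdd-complete h       (up ∷ w)   sp =
    beforeOdd′-complete h w (special-up⁻ (evenAt-up h) sp)
  beforeOdd-complete zero    (down ∷ w) (returns (-≤- () ∷ _) _ , _)
  beforeOdd-complete (suc h) (down ∷ w) sp =
    beforeOdd-complete h w (special-down⁻ refl (evenAt-parity h) sp)

  beforeOdd′-complete : ∀ h w → Special 1 (oddAbove h) w → beforeOdd′ h w ≡ true
  beforeOdd′-complete h []         (returns _ () , _)
  beforeOdd′-complete h (up ∷ w)   sp =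
    beforeOdd-complete (suc h) w (special-up⁻ (oddAbove-up h) sp)
  beforeOdd′-complete h (down ∷ w) sp =
    afterOdd′-complete h w (special-down⁻ (oddAbove-down h) (oddBelow-parity h) sp)

  afterOdd-complete : ∀ h w → Special 0 (evenAt h) w → afterOdd h w ≡ true
  afterOdd-complete h       (up ∷ w)   sp =
    afterOdd′-complete (suc h) w (special-up⁻ (evenAt-up h) sp)
  afterOdd-complete zero    []         _  = refl
  afterOdd-complete (suc h) []         (returns _ () , _)
  afterOdd-complete zero    (down ∷ w) (returns (-≤- () ∷ _) _ , _)
  afterOdd-complete (suc h) (down ∷ w) sp =
    afterOdd-complete h w (special-down⁻ refl (evenAt-parity h) sp)

  afterOdd′-complete : ∀ h w → Special 0 (oddBelow h) w → afterOdd′ h w ≡ true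
  afterOdd′-complete zero    []         (returns _ () , _)
  afterOdd′-complete (suc h) []         (returns _ () , _)
  afterOdd′-complete h       (up ∷ w)   sp =
    afterOdd-complete h w (special-up⁻ (oddBelow-up h) sp)
  afterOdd′-complete zero    (down ∷ w) sp = ⊥-elim (special-odd-exhausted refl refl sp)
  afterOdd′-complete (suc h) (down ∷ w) sp =
    ⊥-elim (special-odd-exhausted (oddAbove-down h) (oddBelow-parity h) sp)

mutual
  beforeOdd-sound : ∀ h w → beforeOdd h w ≡ true → Special 1 (evenAt h) w
  beforeOdd-sound h       (up ∷ w)   e =
    special-up⁺ (evenAt-up h) -≤+ (beforeOdd′-sound h w e)
  beforeOdd-sound (suc h) (down ∷ w) e =
    special-down⁺ refl (evenAt-parity h) -≤+ (beforeOdd-sound h w e)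

  beforeOdd′-sound : ∀ h w → beforeOdd′ h w ≡ true → Special 1 (oddAbove h) w
  beforeOdd′-sound h (up ∷ w)   e = special-up⁺ (oddAbove-up h) -≤+ (beforeOdd-sound (suc h) w e)
  beforeOdd′-sound h (down ∷ w) e =
    special-down⁺ (oddAbove-down h) (oddBelow-parity h) (oddBelow-bounded h) (afterOdd′-sound h w e)

  afterOdd-sound : ∀ h w → afterOdd h w ≡ true → Special 0 (evenAt h) w
  afterOdd-sound h       (up ∷ w)   e =
    special-up⁺ (evenAt-up h) (oddBelow-bounded (suc h)) (afterOdd′-sound (suc h) w e)
  afterOdd-sound zero    []         _ = returns [] refl , refl
  afterOdd-sound (suc h) (down ∷ w) e =
    special-down⁺ refl (evenAt-parity h) -≤+ (afterOdd-sound h w e)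

  afterOdd′-sound : ∀ h w → afterOdd′ h w ≡ true → Special 0 (oddBelow h) w
  afterOdd′-sound h (up ∷ w) e = special-up⁺ (oddBelow-up h) -≤+ (afterOdd-sound h w e)

height-up : ∀ h → + h ℤ.+ + 1 ≡ + suc h
height-up h = cong +_ (+-comm h 1)

ballot-complete : ∀ h w → ReturnsToZero 1 0 (+ h) w → ballot h w ≡ true
ballot-complete h       (up ∷ w)   r = ballot-complete (suc h) w (returnsToZero-step⁻ (height-up h) r)
ballot-complete zero    []         _ = refl
ballot-complete (suc h) []         (returns _ ())
ballot-complete zero    (down ∷ w) (returns (() ∷ _) _)
ballot-complete (suc h) (down ∷ w) r = ballot-complete h w (returnsToZero-step⁻ refl r)

ballot-sound : ∀ h w → ballot h w ≡ true → ReturnsToZero 1 0 (+ h) w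
ballot-sound h       (up ∷ w)   e =
  returnsToZero-step⁺ (height-up h) (+≤+ z≤n) (ballot-sound (suc h) w e)
ballot-sound zero    []         _ = returns [] refl
ballot-sound (suc h) (down ∷ w) e = returnsToZero-step⁺ refl (+≤+ z≤n) (ballot-sound h w e)

SpecialCounts : ℕ → List Step → Set
SpecialCounts n p = downsAtHeightMod 2 1 p ≡ 1 × downsAtHeightMod 2 2 p ≡ n ∸ 1

specialCounts? : ∀ n → Decidable (SpecialCounts n)
specialCounts? n p = (downsAtHeightMod 2 1 p ≟ 1) ×-dec (downsAtHeightMod 2 2 p ≟ n ∸ 1)

beforeOdd-complete-KTDyck : ∀ n w → IsKTDyck 2 1 n w × SpecialCounts n w → beforeOdd 0 w ≡ true
beforeOdd-complete-KTDyck n w ((_ , _ , ends , above) , oneOdd , _) =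
  beforeOdd-complete 0 w (returns above ends , oneOdd)

beforeOdd-sound-KTDyck : ∀ n w → length w ≡ 3 * n → beforeOdd 0 w ≡ true →
  IsKTDyck 2 1 n w × SpecialCounts n w
beforeOdd-sound-KTDyck n w |w|≡3n accepted with beforeOdd-sound 0 w accepted
... | returns above ends , oneOdd = (d≡n , u≡2n , ends , above) , oneOdd , evens
  where
  counts = closedPath-counts 2 n w ends |w|≡3n
  d≡n = proj₁ counts
  u≡2n = proj₂ counts
  hs = downHeights 2 0ℤ w
  evens : downsAtHeightMod 2 2 w ≡ n ∸ 1
  evens = cong (_∸ 1) (begin
    1 + countEven hs              ≡⟨ cong (_+ countEven hs) (sym oneOdd) ⟩
    countOdd hs + countEven hs    ≡⟨ countOdd+countEven hs ⟩
    length hs                     ≡⟨ length-downHeights 2 0ℤ w ⟩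
    countSteps down w             ≡⟨ d≡n ⟩
    n                             ∎)
    where open ≡-Reasoning

ballot-complete-Dyck : ∀ n w → IsDyck n w → ballot 0 w ≡ true
ballot-complete-Dyck n w (_ , _ , ends , above) = ballot-complete 0 w (returns above ends)

ballot-sound-Dyck : ∀ n w → length w ≡ 2 * n → ballot 0 w ≡ true → IsDyck n w
ballot-sound-Dyck n w |w|≡2n accepted with ballot-sound 0 w accepted
... | returns above ends = trans (proj₂ counts) (*-identityˡ n) , proj₁ counts , ends , above
  where counts = closedPath-counts 1 n w ends |w|≡2n

countSpecial≡sumWords : ∀ n → countSpecial n ≡ sumWords (3 * n) (BeforeOdd 0)
countSpecial≡sumWords n = begin
  countSpecial n
    ≡⟨ length-filter≡sum (specialCounts? n) (ktDyckPaths 2 1 n) ⟩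
  sum (map (λ w → toℕ (does (specialCounts? n w))) (ktDyckPaths 2 1 n))
    ≡⟨ sum-map-filter (isKTDyck? 2 1 n) _ (allWords (3 * n)) ⟩
  sumWords (3 * n) (λ w → toℕ (does (isKTDyck? 2 1 n w)) * toℕ (does (specialCounts? n w)))
    ≡⟨ sumWords-cong (3 * n) indicator ⟩
  sumWords (3 * n) (BeforeOdd 0)
    ∎
  where
  open ≡-Reasoning
  indicator : ∀ w → length w ≡ 3 * n →
    toℕ (does (isKTDyck? 2 1 n w)) * toℕ (does (specialCounts? n w)) ≡ BeforeOdd 0 w
  indicator w |w|≡3n = trans (sym (toℕ-does-×-dec (isKTDyck? 2 1 n w) (specialCounts? n w)))
    (cong toℕ (does-≡ (isKTDyck? 2 1 n w ×-dec specialCounts? n w)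
                      (beforeOdd-complete-KTDyck n w) (beforeOdd-sound-KTDyck n w |w|≡3n)))

totalPeaks≡sumWords : ∀ n → totalPeaks n ≡ sumWords (2 * n) (BallotPeaks 0)
totalPeaks≡sumWords n =
  trans (sum-map-filter (isDyck? n) peaks (allWords (2 * n))) (sumWords-cong (2 * n) indicator)
  where
  indicator : ∀ w → length w ≡ 2 * n → toℕ (does (isDyck? n w)) * peaks w ≡ BallotPeaks 0 w
  indicator w |w|≡2n = cong (λ b → toℕ b * peaks w)
    (does-≡ (isDyck? n w) (ballot-complete-Dyck n w) (ballot-sound-Dyck n w |w|≡2n))

mainTheorem7 : (n : ℕ) → 1 ≤ n → countSpecial n ≡ totalPeaks n
mainTheorem7 (suc m) _ = begin
  countSpecial (suc m)                  ≡⟨ countSpecial≡sumWords (suc m) ⟩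
  sumWords (3 * suc m) (BeforeOdd 0)    ≡⟨ cong (λ l → sumWords l (BeforeOdd 0)) (*-comm 3 (suc m)) ⟩
  beforeOddCount m 0                    ≡⟨ beforeOddCount≡markedPeakCount m 0 ⟩
  markedPeakCount m 0                   ≡⟨ cong (λ l → sumWords l (BallotPeaks 0)) (*-comm (suc m) 2) ⟩
  sumWords (2 * suc m) (BallotPeaks 0)  ≡⟨ sym (totalPeaks≡sumWords (suc m)) ⟩
  totalPeaks (suc m)                    ∎
  where open ≡-Reasoning
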